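{- Let $G$ be a graph with $\mathrm{diam}(G)\geq3$, and let $H$ be a graph containing two adjacent vertices $h_{1},h_{2}$ such that $N_{H}(h_{1})\cap N_{H}(h_{2})=\emptyset$. If $N_{H}(h_{1})\cup N_{H}(h_{2})\neq V(H)$, then $\gamma(G\diamond H)\leq4$.
   Context: All graphs are finite, simple and undirected; $N_H(v)$ is the open neighborhood of $v$; $\mathrm{diam}(G)$ is the maximum distance between two vertices of $G$. The modular product $G\diamond H$ has vertex set $V(G)\times V(H)$, and two distinct vertices $(g,h)$ and $(g',h')$ are adjacent iff either ($g=g'$ and $hh'\in E(H)$), or ($gg'\in E(G)$ and $h=h'$), or ($gg'\in E(G)$ and $hh'\in E(H)$), or ($g\neq g'$, $h\neq h'$, $gg'\notin E(G)$ and $hh'\notin E(H)$). $\gamma$ denotes the domination number. -}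

module Defs where

open import Data.Nat using (ℕ; zero; suc; _≤_; _<_)
open import Data.Fin using (Fin)
open import Data.Bool using (Bool; true; false; T)
open import Data.Product using (_×_; _,_; ∃-syntax; Σ)
open import Data.Sum using (_⊎_)
open import Data.List using (List; length)
open import Data.List.Relation.Unary.Any using (Any)
open import Relation.Nullary using (¬_)
open import Relation.Binary.PropositionalEquality using (_≡_; _≢_)

record Graph : Set where
  field
    n     : ℕ
    adj   : Fin n → Fin n → Bool
    sym   : ∀ u v → adj u v ≡ adj v u
    irrfl : ∀ u → adj u u ≡ false

open Graph public

V : Graph → Set
V G = Fin (n G)

E : (G : Graph) → V G → V G → Set
E G u v = T (adj G u v)

data Walk (G : Graph) : V G → V G → ℕ → Set where
  here : ∀ {u} → Walk G u u zero
  step : ∀ {u v w k} → E G u v → Walk G v w k → Walk G u w (suc k)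

-- dist(u,v) ≥ k  (no walk of length < k; includes dist = ∞)
DistAtLeast : (G : Graph) → V G → V G → ℕ → Set
DistAtLeast G u v k = ∀ m → m < k → ¬ Walk G u v m

DiamAtLeast : Graph → ℕ → Set
DiamAtLeast G k = ∃[ u ] ∃[ v ] DistAtLeast G u v k

ModVertex : Graph → Graph → Set
ModVertex G H = V G × V H

ModAdj : (G H : Graph) → ModVertex G H → ModVertex G H → Set
ModAdj G H (g , h) (g' , h') =
  ((g ≡ g') × E H h h')
  ⊎ (E G g g' × (h ≡ h'))
  ⊎ (E G g g' × E H h h')
  ⊎ ((g ≢ g') × (h ≢ h') × ¬ E G g g' × ¬ E H h h')

Dominating : (G H : Graph) → List (ModVertex G H) → Set
Dominating G H D = ∀ x → Any (λ d → d ≡ x ⊎ ModAdj G H d x) D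

DomNumAtMost : (G H : Graph) → ℕ → Set
DomNumAtMost G H k = ∃[ D ] (Dominating G H D × length D ≤ k)

{-# OPTIONS --safe #-}
-- Take u, v at distance ≥ 3 in G and w ∈ V(H) adjacent to neither h₁ nor h₂.
-- In the modular product, (g′, h′) dominates (g, h) whenever g ∈ N[g′] ⇔ h ∈ N[h′]
-- (closed neighbourhoods). So D = {(u,h₁), (u,h₂), (u,w), (v,w)} dominates:
-- for g ∈ N[u] use (u,w) if h ∈ N[w] and (v,w) otherwise, since g ∉ N[v];
-- for g ∉ N[u] some b ∈ {h₁, h₂, w} has h ∉ N[b], because N[h₁] ∩ N[h₂] ⊆ {h₁, h₂}
-- and w lies in no N[hᵢ].
module Submission where

open import Defs
open import Data.Bool using (T)
open import Data.Bool.Properties using (T?)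
open import Data.Empty using (⊥-elim)
open import Data.Fin using (_≟_)
open import Data.Fin.Properties using (¬∀⟶∃¬)
open import Data.List using (List; _∷_; [])
open import Data.List.Relation.Unary.Any using (here; there)
open import Data.Nat using (z<s; s<s)
open import Data.Nat.Properties using (≤-refl)
open import Data.Product using (_×_; _,_)
open import Data.Sum using (_⊎_; inj₁; inj₂; swap)
open import Function using (_∘_)
open import Relation.Nullary using (¬_; Dec; yes; no)
open import Relation.Nullary.Decidable using (_⊎-dec_)
open import Relation.Binary.PropositionalEquality using (_≡_; refl; subst)

ClosedNbr : (G : Graph) → V G → V G → Set
ClosedNbr G x y = x ≡ y ⊎ E G x y

Dominates : (G H : Graph) → ModVertex G H → ModVertex G H → Set
Dominates G H d x = d ≡ x ⊎ ModAdj G H d x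

module _ (G : Graph) where

  E-sym : ∀ {x y} → E G x y → E G y x
  E-sym {x} {y} = subst T (sym G x y)

  E? : ∀ x y → Dec (E G x y)
  E? x y = T? (adj G x y)

  closedNbr? : ∀ x y → Dec (ClosedNbr G x y)
  closedNbr? x y = (x ≟ y) ⊎-dec E? x y

  closedNbr-sym : ∀ {x y} → ClosedNbr G x y → ClosedNbr G y x
  closedNbr-sym (inj₁ refl) = inj₁ refl
  closedNbr-sym (inj₂ e)    = inj₂ (E-sym e)

  closedNbr⇒nbr-of-edge : ∀ {a b x} → E G a b → ClosedNbr G a x → E G a x ⊎ E G b x
  closedNbr⇒nbr-of-edge ab (inj₁ refl) = inj₂ (E-sym ab)
  closedNbr⇒nbr-of-edge ab (inj₂ ax)   = inj₁ ax

  common-closedNbr : ∀ {a b x} → (∀ y → ¬ (E G a y × E G b y)) →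
                     ClosedNbr G a x → ClosedNbr G b x → a ≡ x ⊎ b ≡ x
  common-closedNbr _        (inj₁ a≡x) _           = inj₁ a≡x
  common-closedNbr _        (inj₂ _)   (inj₁ b≡x)  = inj₂ b≡x
  common-closedNbr noCommon (inj₂ ax)  (inj₂ bx)   = ⊥-elim (noCommon _ (ax , bx))

  distAtLeast3⇒disjoint-closedNbrs : ∀ {u v g} → DistAtLeast G u v 3 →
                                     ClosedNbr G u g → ¬ ClosedNbr G v g
  distAtLeast3⇒disjoint-closedNbrs far (inj₁ refl) (inj₁ refl) = far 0 z<s here
  distAtLeast3⇒disjoint-closedNbrs far (inj₁ refl) (inj₂ vu)   = far 1 (s<s z<s) (step (E-sym vu) here)
  distAtLeast3⇒disjoint-closedNbrs far (inj₂ uv)   (inj₁ refl) = far 1 (s<s z<s) (step uv here)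
  distAtLeast3⇒disjoint-closedNbrs far (inj₂ ug)   (inj₂ vg)   =
    far 2 (s<s (s<s z<s)) (step ug (step (E-sym vg) here))

closedNbrs-of-edge-and-far-vertex-disjoint :
  (H : Graph) {h₁ h₂ w : V H} → E H h₁ h₂ → (∀ x → ¬ (E H h₁ x × E H h₂ x)) →
  ¬ (E H h₁ w ⊎ E H h₂ w) →
  ∀ h → ¬ (ClosedNbr H h₁ h × ClosedNbr H h₂ h × ClosedNbr H w h)
closedNbrs-of-edge-and-far-vertex-disjoint H h₁h₂ noCommon w-far h (n₁ , n₂ , nw)
  with common-closedNbr H noCommon n₁ n₂
... | inj₁ refl = w-far (closedNbr⇒nbr-of-edge H h₁h₂ (closedNbr-sym H nw))
... | inj₂ refl = w-far (swap (closedNbr⇒nbr-of-edge H (E-sym H h₁h₂) (closedNbr-sym H nw)))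

module _ (G H : Graph) {g g′ : V G} {h h′ : V H} where

  dominates-closedNbr : ClosedNbr G g′ g → ClosedNbr H h′ h → Dominates G H (g′ , h′) (g , h)
  dominates-closedNbr (inj₁ refl) (inj₁ refl) = inj₁ refl
  dominates-closedNbr (inj₁ refl) (inj₂ hh)   = inj₂ (inj₁ (refl , hh))
  dominates-closedNbr (inj₂ gg)   (inj₁ refl) = inj₂ (inj₂ (inj₁ (gg , refl)))
  dominates-closedNbr (inj₂ gg)   (inj₂ hh)   = inj₂ (inj₂ (inj₂ (inj₁ (gg , hh))))

  dominates-¬closedNbr : ¬ ClosedNbr G g′ g → ¬ ClosedNbr H h′ h → Dominates G H (g′ , h′) (g , h)
  dominates-¬closedNbr ¬gg ¬hh =
    inj₂ (inj₂ (inj₂ (inj₂ (¬gg ∘ inj₁ , ¬hh ∘ inj₁ , ¬gg ∘ inj₂ , ¬hh ∘ inj₂))))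

module _ (G H : Graph) {u v : V G} (far : DistAtLeast G u v 3) {h₁ h₂ w : V H}
         (disjoint : ∀ h → ¬ (ClosedNbr H h₁ h × ClosedNbr H h₂ h × ClosedNbr H w h)) where

  dominatingSet : List (ModVertex G H)
  dominatingSet = (u , h₁) ∷ (u , h₂) ∷ (u , w) ∷ (v , w) ∷ []

  dominatingSet-dominates : Dominating G H dominatingSet
  dominatingSet-dominates (g , h) with closedNbr? G u g
  ... | yes ug with closedNbr? H w h
  ...   | yes wh = there (there (here (dominates-closedNbr G H ug wh)))
  ...   | no ¬wh = there (there (there (here
                     (dominates-¬closedNbr G H (distAtLeast3⇒disjoint-closedNbrs G far ug) ¬wh))))
  dominatingSet-dominates (g , h) | no ¬ug
    with closedNbr? H h₁ h | closedNbr? H h₂ h | closedNbr? H w h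
  ... | no ¬n₁ | _      | _      = here (dominates-¬closedNbr G H ¬ug ¬n₁)
  ... | yes _  | no ¬n₂ | _      = there (here (dominates-¬closedNbr G H ¬ug ¬n₂))
  ... | yes _  | yes _  | no ¬nw = there (there (here (dominates-¬closedNbr G H ¬ug ¬nw)))
  ... | yes n₁ | yes n₂ | yes nw = ⊥-elim (disjoint h (n₁ , n₂ , nw))

proposition30 : (G H : Graph) → DiamAtLeast G 3
    → (h₁ h₂ : V H) → E H h₁ h₂
    → (∀ x → ¬ (E H h₁ x × E H h₂ x))
    → ¬ (∀ x → E H h₁ x ⊎ E H h₂ x)
    → DomNumAtMost G H 4
proposition30 G H (u , v , far) h₁ h₂ h₁h₂ noCommon notCovering
  with ¬∀⟶∃¬ (n H) (λ x → E H h₁ x ⊎ E H h₂ x) (λ x → E? H h₁ x ⊎-dec E? H h₂ x) notCovering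
... | w , w-far = dominatingSet G H far disjoint , dominatingSet-dominates G H far disjoint , ≤-refl
  where
  disjoint : ∀ h → ¬ (ClosedNbr H h₁ h × ClosedNbr H h₂ h × ClosedNbr H w h)
  disjoint = closedNbrs-of-edge-and-far-vertex-disjoint H h₁h₂ noCommon w-far
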